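{- Let $\vec{x}=(x_1,\ldots,x_t)$ be a generalized Catalan list of nonzero integers with exactly two runs (i.e. $y=1$), let $\alpha_1$ be the maximum entry of its up-run and $\beta_1$ the maximum absolute value of an entry of its down-run. If ${\sf cost}(\vec{x})={\sf width}(\vec{x})$ and $\vec{x}$ is not reducible, then every entry of $\vec{x}$ equals either $\alpha_1$ or $-\beta_1$, and $\alpha_1$ and $\beta_1$ are relatively prime.
   Context: A list $\vec{x}=(x_1,\ldots,x_t)$ of nonzero integers is generalized Catalan if $\sum_{i=1}^t x_i=0$ and $\sum_{i=1}^q x_i\ge0$ for all $1\le q\le t$. A sublist is $(x_{i_1},\ldots,x_{i_a})$ with $i_1<\cdots<i_a$; its complementary sublist consists of the remaining entries in order. $\vec{x}$ is reducible if there is a generalized Catalan sublist whose complementary sublist is also generalized Catalan. A run is a maximal consecutive sublist of entries of the same sign (up-run: positive entries; down-run: negative entries); a generalized Catalan list has an even number $2y$ of runs. If $a_k>0$ is the maximum absolute value of an entry in the $k$-th run, ${\sf cost}(\vec{x})=\sum_{k=1}^{2y}a_k$ and ${\sf width}(\vec{x})=t$. -}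

module Defs where

open import Data.Bool using (Bool; true; false; not; if_then_else_)
open import Data.Nat as ℕ using (ℕ; _⊔_)
open import Data.Integer as ℤ using (ℤ; 0ℤ; _+_; _≤_; _<?_; ∣_∣)
open import Data.List using (List; []; _∷_; foldr; map; length; inits)
open import Data.List.Relation.Unary.All using (All)
open import Data.Product using (_×_; ∃-syntax)
open import Relation.Binary.PropositionalEquality using (_≡_; _≢_)
open import Relation.Nullary using (does)

sumℤ : List ℤ → ℤ
sumℤ = foldr _+_ 0ℤ

NonzeroList : List ℤ → Set
NonzeroList xs = All (λ x → x ≢ 0ℤ) xs

GenCatalan : List ℤ → Set
GenCatalan xs = (sumℤ xs ≡ 0ℤ) × All (λ p → 0ℤ ≤ sumℤ p) (inits xs)

-- sublists are described by a Boolean mask of the same length;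
-- 'select m xs' keeps the entries where the mask is true (order preserved)
select : List Bool → List ℤ → List ℤ
select [] _ = []
select (_ ∷ _) [] = []
select (true ∷ m) (x ∷ xs) = x ∷ select m xs
select (false ∷ m) (x ∷ xs) = select m xs

NonEmpty : List ℤ → Set
NonEmpty xs = ∃[ y ] ∃[ ys ] xs ≡ y ∷ ys

Reducible : List ℤ → Set
Reducible xs = ∃[ m ] (length m ≡ length xs)
  × NonEmpty (select m xs) × NonEmpty (select (map not m) xs)
  × GenCatalan (select m xs) × GenCatalan (select (map not m) xs)

-- runs: maximal consecutive blocks of entries of the same sign
isPos : ℤ → Bool
isPos x = does (0ℤ <? x)

insertRun : ℤ → List (List ℤ) → List (List ℤ)
insertRun x [] = (x ∷ []) ∷ []
insertRun x ([] ∷ rs) = (x ∷ []) ∷ rs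
insertRun x ((y ∷ r) ∷ rs) with isPos x | isPos y
... | true  | true  = (x ∷ y ∷ r) ∷ rs
... | false | false = (x ∷ y ∷ r) ∷ rs
... | _     | _     = (x ∷ []) ∷ (y ∷ r) ∷ rs

runs : List ℤ → List (List ℤ)
runs = foldr insertRun []

maxAbs : List ℤ → ℕ
maxAbs = foldr (λ e m → ∣ e ∣ ⊔ m) 0

cost : List ℤ → ℕ
cost xs = foldr ℕ._+_ 0 (map maxAbs (runs xs))

width : List ℤ → ℕ
width = length

-- Write the up-run as the positive parts us and the down-run as −vs. A reduction is then a
-- pair of sub-multisets of us and vs, nonempty and not everything, with equal sums; this
-- notion does not depend on the order of us. Merge us and vs greedily, taking from us
-- whenever its prefix sum is not ahead; along the merge the difference of the prefix sums
-- stays in (−b, a], with a = max us and b = max vs. If the first part of us were below a,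
-- the difference would stay below a at every one of the |us| + |vs| ≥ a + b steps, so by
-- pigeonhole two steps would share it and the parts merged in between would form a
-- reduction. Moving any part of us to the front, all parts of us equal a; likewise all parts
-- of vs equal b. Finally, if d divides a and b, then b/d copies of a balance a/d copies of b;
-- irreducibility forces these to be everything, so a + b = |us| + |vs| ≤ (a + b)/d and d = 1.
module Submission where

open import Data.Bool using (Bool; true; false; not)
open import Data.Bool.Properties using (¬-not)
open import Data.Empty using (⊥; ⊥-elim)
open import Data.Fin as Fin using (Fin; toℕ; fromℕ<)
open import Data.Fin.Properties using (pigeonhole; toℕ<n; toℕ-fromℕ<)
open import Data.Integer as ℤ using (ℤ; +_; -_; -[1+_]; 0ℤ; ∣_∣; +≤+; +<+)
import Data.Integer.Properties as ℤ
open import Data.List using (List; []; _∷_; _++_; length; map; foldr; take; drop; replicate; inits; concat)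
open import Data.List.Membership.Propositional.Properties using (∈-∃++)
open import Data.List.Properties
  using (length-replicate; length-take; length-drop; length-map; length-++; take-all; take-[]; map-++;
         ++-identityʳ; map-∘; map-id-local)
open import Data.List.Relation.Binary.Permutation.Propositional as ↭
  using (_↭_; ↭-refl; ↭-trans; ↭-prep; ↭-swap; ↭-sym; ↭-reflexive)
open import Data.List.Relation.Binary.Permutation.Propositional.Properties using (↭-length; shift; All-resp-↭)
open import Data.List.Relation.Unary.All as All using (All; []; _∷_)
open import Data.List.Relation.Unary.All.Properties using (take⁺; map⁺; ++⁻ˡ; ++⁻ʳ; ++⁺)
open import Data.Nat
open import Data.Nat.Coprimality using (Coprime)
open import Data.Nat.Divisibility using (divides)
open import Data.Nat.ListAction using (sum)
open import Data.Nat.ListAction.Properties using (sum-↭)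
open import Data.Nat.Properties
open import Data.Product using (_×_; _,_; proj₁; proj₂; ∃-syntax; ∃₂)
open import Data.Sum using (_⊎_; inj₁; inj₂)
open import Data.Unit using (⊤; tt)
open import Function using (_∘_)
open import Relation.Binary.PropositionalEquality
open import Relation.Nullary using (¬_; Dec; yes; no)
open import Relation.Nullary.Decidable using (dec-true)

open import Defs

open import Algebra.Properties.CommutativeSemigroup +-commutativeSemigroup using (x∙yz≈y∙xz; xy∙z≈xz∙y; interchange)
import Algebra.Properties.CommutativeSemigroup *-commutativeSemigroup as *-Properties

private variable
  A : Set
  mask : List Bool
  xs ys : List A
  us us′ vs : List ℕ

-- Defs' `select`, for lists of any type (see `select≡sel`).
sel : List Bool → List A → List A
sel [] _ = []
sel (_ ∷ _) [] = []
sel (true ∷ m) (x ∷ xs) = x ∷ sel m xs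
sel (false ∷ m) (x ∷ xs) = sel m xs

sel-++ : ∀ m₁ m₂ (xs ys : List A) → length m₁ ≡ length xs →
         sel (m₁ ++ m₂) (xs ++ ys) ≡ sel m₁ xs ++ sel m₂ ys
sel-++ [] m₂ [] ys _ = refl
sel-++ (true ∷ m₁) m₂ (x ∷ xs) ys eq = cong (x ∷_) (sel-++ m₁ m₂ xs ys (suc-injective eq))
sel-++ (false ∷ m₁) m₂ (x ∷ xs) ys eq = sel-++ m₁ m₂ xs ys (suc-injective eq)

sel-map : ∀ {B : Set} (f : A → B) m xs → sel m (map f xs) ≡ map f (sel m xs)
sel-map f [] xs = refl
sel-map f (_ ∷ _) [] = refl
sel-map f (true ∷ m) (x ∷ xs) = cong (f x ∷_) (sel-map f m xs)
sel-map f (false ∷ m) (x ∷ xs) = sel-map f m xs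

length-sel-complement : ∀ m (xs : List A) → length m ≡ length xs →
                        length (sel m xs) + length (sel (map not m) xs) ≡ length xs
length-sel-complement [] [] _ = refl
length-sel-complement (true ∷ m) (x ∷ xs) eq = cong suc (length-sel-complement m xs (suc-injective eq))
length-sel-complement (false ∷ m) (x ∷ xs) eq =
  trans (+-suc _ _) (cong suc (length-sel-complement m xs (suc-injective eq)))

sum-sel-complement : ∀ m xs → length m ≡ length xs → sum (sel m xs) + sum (sel (map not m) xs) ≡ sum xs
sum-sel-complement [] [] _ = refl
sum-sel-complement (true ∷ m) (x ∷ xs) eq =
  trans (+-assoc x _ _) (cong (_+_ x) (sum-sel-complement m xs (suc-injective eq)))
sum-sel-complement (false ∷ m) (x ∷ xs) eq =
  trans (x∙yz≈y∙xz (sum (sel m xs)) x _) (cong (_+_ x) (sum-sel-complement m xs (suc-injective eq)))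

window : ℕ → ℕ → ℕ → List Bool
window i k r = replicate i false ++ replicate k true ++ replicate r false

length-window : ∀ i k r → length (window i k r) ≡ i + (k + r)
length-window zero zero r = length-replicate r
length-window zero (suc k) r = cong suc (length-window 0 k r)
length-window (suc i) k r = cong suc (length-window i k r)

sel-falses : ∀ r (xs : List A) → sel (replicate r false) xs ≡ []
sel-falses zero xs = refl
sel-falses (suc r) [] = refl
sel-falses (suc r) (x ∷ xs) = sel-falses r xs

sel-window : ∀ i k r (xs : List A) → sel (window i k r) xs ≡ take k (drop i xs)
sel-window zero zero r xs = sel-falses r xs
sel-window zero (suc k) r [] = refl
sel-window zero (suc k) r (x ∷ xs) = cong (x ∷_) (sel-window zero k r xs)
sel-window (suc i) zero r [] = refl
sel-window (suc i) (suc k) r [] = refl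
sel-window (suc i) k r (x ∷ xs) = sel-window i k r xs

permute-mask : xs ↭ ys → List Bool → List Bool
permute-mask ↭.refl m = m
permute-mask (↭.prep _ p) (c ∷ m) = c ∷ permute-mask p m
permute-mask (↭.swap _ _ p) (c ∷ d ∷ m) = d ∷ c ∷ permute-mask p m
permute-mask (↭.trans p q) m = permute-mask q (permute-mask p m)
permute-mask _ m = m  -- only reached by masks shorter than the list

length-permute-mask : (p : xs ↭ ys) → length mask ≡ length xs → length (permute-mask p mask) ≡ length ys
length-permute-mask ↭.refl eq = eq
length-permute-mask {mask = c ∷ m} (↭.prep _ p) eq = cong suc (length-permute-mask p (suc-injective eq))
length-permute-mask {mask = c ∷ d ∷ m} (↭.swap _ _ p) eq =
  cong (suc ∘ suc) (length-permute-mask p (suc-injective (suc-injective eq)))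
length-permute-mask (↭.trans p q) eq = length-permute-mask q (length-permute-mask p eq)

permute-mask-not : (p : xs ↭ ys) → ∀ m → permute-mask p (map not m) ≡ map not (permute-mask p m)
permute-mask-not ↭.refl m = refl
permute-mask-not (↭.prep _ p) [] = refl
permute-mask-not (↭.prep _ p) (c ∷ m) = cong (not c ∷_) (permute-mask-not p m)
permute-mask-not (↭.swap _ _ p) [] = refl
permute-mask-not (↭.swap _ _ p) (c ∷ []) = refl
permute-mask-not (↭.swap _ _ p) (c ∷ d ∷ m) = cong (λ m′ → not d ∷ not c ∷ m′) (permute-mask-not p m)
permute-mask-not (↭.trans p q) m =
  trans (cong (permute-mask q) (permute-mask-not p m)) (permute-mask-not q (permute-mask p m))

sel-permute-mask : (p : xs ↭ ys) → length mask ≡ length xs → sel mask xs ↭ sel (permute-mask p mask) ys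
sel-permute-mask ↭.refl eq = ↭-refl
sel-permute-mask {mask = true ∷ m} (↭.prep x p) eq = ↭-prep x (sel-permute-mask p (suc-injective eq))
sel-permute-mask {mask = false ∷ m} (↭.prep x p) eq = sel-permute-mask p (suc-injective eq)
sel-permute-mask {mask = c ∷ d ∷ m} (↭.swap x y p) eq
  with sel-permute-mask {mask = m} p (suc-injective (suc-injective eq))
sel-permute-mask {mask = true ∷ true ∷ m} (↭.swap x y p) eq | rec = ↭-swap x y rec
sel-permute-mask {mask = true ∷ false ∷ m} (↭.swap x y p) eq | rec = ↭-prep x rec
sel-permute-mask {mask = false ∷ true ∷ m} (↭.swap x y p) eq | rec = ↭-prep y rec
sel-permute-mask {mask = false ∷ false ∷ m} (↭.swap x y p) eq | rec = rec
sel-permute-mask (↭.trans p q) eq =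
  ↭-trans (sel-permute-mask p eq) (sel-permute-mask q (length-permute-mask p eq))

length-take-drop : ∀ i k (xs : List A) → i + k ≤ length xs → length (take k (drop i xs)) ≡ k
length-take-drop i k xs i+k≤ = begin
  length (take k (drop i xs))   ≡⟨ length-take k (drop i xs) ⟩
  k ⊓ length (drop i xs)        ≡⟨ cong (k ⊓_) (length-drop i xs) ⟩
  k ⊓ (length xs ∸ i)           ≡⟨ m≤n⇒m⊓n≡m (subst (_≤ length xs ∸ i) (m+n∸m≡n i k) (∸-monoˡ-≤ i i+k≤)) ⟩
  k                             ∎
  where open ≡-Reasoning

record BalancedSplit (us vs : List ℕ) : Set where
  field
    mu mv : List Bool
    length-mu : length mu ≡ length us
    length-mv : length mv ≡ length vs
    balanced : sum (sel mu us) ≡ sum (sel mv vs)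
    nonempty : 0 < length (sel mu us) + length (sel mv vs)
    co-nonempty : 0 < length (sel (map not mu) us) + length (sel (map not mv) vs)

Irreducible : List ℕ → List ℕ → Set
Irreducible us vs = ¬ BalancedSplit us vs

BalancedSplit-swap : BalancedSplit us vs → BalancedSplit vs us
BalancedSplit-swap s = record
  { mu = mv ; mv = mu ; length-mu = length-mv ; length-mv = length-mu
  ; balanced = sym balanced
  ; nonempty = subst (0 <_) (+-comm (length (sel mu _)) _) nonempty
  ; co-nonempty = subst (0 <_) (+-comm (length (sel (map not mu) _)) _) co-nonempty
  }
  where open BalancedSplit s

BalancedSplit-↭ : us ↭ us′ → BalancedSplit us vs → BalancedSplit us′ vs
BalancedSplit-↭ {vs = vs} p s = record
  { mu = permute-mask p mu ; mv = mv
  ; length-mu = length-permute-mask p length-mu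
  ; length-mv = length-mv
  ; balanced = trans (sym (sum-↭ selected)) balanced
  ; nonempty = subst (λ n → 0 < n + length (sel mv vs)) (↭-length selected) nonempty
  ; co-nonempty = subst (λ n → 0 < n + length (sel (map not mv) vs)) (↭-length unselected) co-nonempty
  }
  where
  open BalancedSplit s
  selected : sel mu _ ↭ sel (permute-mask p mu) _
  selected = sel-permute-mask p length-mu
  unselected : sel (map not mu) _ ↭ sel (map not (permute-mask p mu)) _
  unselected = subst (λ m → sel (map not mu) _ ↭ sel m _) (permute-mask-not p mu)
    (sel-permute-mask p (trans (length-map not mu) length-mu))

complement-nonempty : ∀ {xs ys : List A} mx my → length mx ≡ length xs → length my ≡ length ys →
                      length (sel mx xs) + length (sel my ys) < length xs + length ys →
                      0 < length (sel (map not mx) xs) + length (sel (map not my) ys)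
complement-nonempty {xs = xs} {ys} mx my eqx eqy lt = +-cancelˡ-< (length (sel mx xs) + length (sel my ys)) 0 _
  (begin-strict
    length (sel mx xs) + length (sel my ys) + 0   ≡⟨ +-identityʳ _ ⟩
    length (sel mx xs) + length (sel my ys)       <⟨ lt ⟩
    length xs + length ys
      ≡⟨ cong₂ _+_ (length-sel-complement mx xs eqx) (length-sel-complement my ys eqy) ⟨
    length (sel mx xs) + length (sel (map not mx) xs) + (length (sel my ys) + length (sel (map not my) ys))
      ≡⟨ interchange (length (sel mx xs)) _ _ _ ⟩
    length (sel mx xs) + length (sel my ys) + (length (sel (map not mx) xs) + length (sel (map not my) ys)) ∎)
  where open ≤-Reasoning

window-split : ∀ i k j l → i + k ≤ length us → j + l ≤ length vs →
               0 < k + l → k + l < length us + length vs →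
               sum (take k (drop i us)) ≡ sum (take l (drop j vs)) → BalancedSplit us vs
window-split {us} {vs} i k j l i+k≤ j+l≤ 0<k+l k+l< sums = record
  { mu = mu ; mv = mv ; length-mu = length-mu ; length-mv = length-mv
  ; balanced = subst₂ (λ x y → sum x ≡ sum y) (sym (sel-window i k _ us)) (sym (sel-window j l _ vs)) sums
  ; nonempty = subst (0 <_) (sym lengths) 0<k+l
  ; co-nonempty = complement-nonempty mu mv length-mu length-mv (subst (_< length us + length vs) (sym lengths) k+l<)
  }
  where
  mu = window i k (length us ∸ (i + k))
  mv = window j l (length vs ∸ (j + l))
  length-mu : length mu ≡ length us
  length-mu = trans (length-window i k _) (trans (sym (+-assoc i k _)) (m+[n∸m]≡n i+k≤))
  length-mv : length mv ≡ length vs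
  length-mv = trans (length-window j l _) (trans (sym (+-assoc j l _)) (m+[n∸m]≡n j+l≤))
  lengths : length (sel mu us) + length (sel mv vs) ≡ k + l
  lengths = cong₂ _+_ (trans (cong length (sel-window i k _ us)) (length-take-drop i k us i+k≤))
                      (trans (cong length (sel-window j l _ vs)) (length-take-drop j l vs j+l≤))

PositiveAtMost : ℕ → ℕ → Set
PositiveAtMost c x = 0 < x × x ≤ c

sum-take-suc : ∀ {P : ℕ → Set} i xs → All P xs → i < length xs →
               ∃[ x ] P x × sum (take (suc i) xs) ≡ sum (take i xs) + x
sum-take-suc zero (x ∷ xs) (px ∷ _) _ = x , px , +-comm x 0
sum-take-suc (suc i) (x ∷ xs) (_ ∷ pxs) (s≤s i<) with sum-take-suc i xs pxs i<
... | y , py , eq = y , py , trans (cong (_+_ x) eq) (sym (+-assoc x _ y))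

sum-take-< : ∀ i xs → All (0 <_) xs → i < length xs → sum (take i xs) < sum xs
sum-take-< zero (x ∷ xs) (0<x ∷ _) _ = ≤-trans 0<x (m≤m+n x _)
sum-take-< (suc i) (x ∷ xs) (_ ∷ pxs) (s≤s i<) = +-monoʳ-< x (sum-take-< i xs pxs i<)

sum-take-length : ∀ xs → sum (take (length xs) xs) ≡ sum xs
sum-take-length xs = cong sum (take-all (length xs) xs ≤-refl)

sum-take-+ : ∀ i k xs → sum (take (i + k) xs) ≡ sum (take i xs) + sum (take k (drop i xs))
sum-take-+ zero k xs = refl
sum-take-+ (suc i) k [] = cong sum (sym (take-[] k))
sum-take-+ (suc i) k (x ∷ xs) = trans (cong (_+_ x) (sum-take-+ i k xs)) (sym (+-assoc x _ _))

∸-cross : ∀ {m n m′ n′} → n ≤ m → n′ ≤ m′ → m ∸ n ≡ m′ ∸ n′ → m + n′ ≡ m′ + n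
∸-cross {m} {n} {m′} {n′} n≤m n′≤m′ eq = begin
  m + n′              ≡⟨ cong (_+ n′) (sym (m∸n+n≡m n≤m)) ⟩
  m ∸ n + n + n′      ≡⟨ cong (λ d → d + n + n′) eq ⟩
  m′ ∸ n′ + n + n′    ≡⟨ xy∙z≈xz∙y (m′ ∸ n′) n n′ ⟩
  m′ ∸ n′ + n′ + n    ≡⟨ cong (_+ n) (m∸n+n≡m n′≤m′) ⟩
  m′ + n              ∎
  where open ≡-Reasoning

cross-sums⇒windows : ∀ {i i′ j j′} xs ys → i ≤ i′ → j ≤ j′ →
                     sum (take i xs) + sum (take j′ ys) ≡ sum (take i′ xs) + sum (take j ys) →
                     sum (take (i′ ∸ i) (drop i xs)) ≡ sum (take (j′ ∸ j) (drop j ys))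
cross-sums⇒windows {i} {i′} {j} {j′} xs ys i≤i′ j≤j′ cross = sym (+-cancelˡ-≡ (P + Q) _ _ (begin
  P + Q + Y                  ≡⟨ +-assoc P Q Y ⟩
  P + (Q + Y)                ≡⟨ cong (_+_ P) (sum-take-∸ ys j≤j′) ⟨
  P + sum (take j′ ys)       ≡⟨ cross ⟩
  sum (take i′ xs) + Q       ≡⟨ cong (_+ Q) (sum-take-∸ xs i≤i′) ⟩
  P + X + Q                  ≡⟨ xy∙z≈xz∙y P X Q ⟩
  P + Q + X                  ∎))
  where
  P Q X Y : ℕ
  P = sum (take i xs)
  Q = sum (take j ys)
  X = sum (take (i′ ∸ i) (drop i xs))
  Y = sum (take (j′ ∸ j) (drop j ys))
  sum-take-∸ : ∀ {m n} zs → m ≤ n → sum (take n zs) ≡ sum (take m zs) + sum (take (n ∸ m) (drop m zs))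
  sum-take-∸ {m} zs m≤n = trans (cong (λ k → sum (take k zs)) (sym (m+[n∸m]≡n m≤n))) (sum-take-+ m _ zs)
  open ≡-Reasoning

-- The greedy merge

module Merge {a b : ℕ} {us vs : List ℕ} (0<b : 0 < b)
             (us-bounds : All (PositiveAtMost a) us) (vs-bounds : All (PositiveAtMost b) vs)
             (sums : sum us ≡ sum vs) (irreducible : Irreducible us vs) where

  p q N : ℕ
  p = length us
  q = length vs
  N = p + q

  P Q : ℕ → ℕ
  P i = sum (take i us)
  Q j = sum (take j vs)

  step : ℕ × ℕ → ℕ × ℕ
  step (i , j) with P i ≤? Q j
  ... | yes _ = suc i , j
  ... | no _ = i , suc j

  data Step : ℕ × ℕ → ℕ × ℕ → Set where
    advance-us : ∀ {i j} → P i ≤ Q j → Step (i , j) (suc i , j)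
    advance-vs : ∀ {i j} → Q j < P i → Step (i , j) (i , suc j)

  step-view : ∀ s → Step s (step s)
  step-view (i , j) with P i ≤? Q j
  ... | yes P≤Q = advance-us P≤Q
  ... | no P≰Q = advance-vs (≰⇒> P≰Q)

  walk : ℕ → ℕ × ℕ
  walk zero = 0 , 0
  walk (suc k) = step (walk k)

  index : ℕ × ℕ → ℕ
  index (i , j) = i + j

  walk-index : ∀ k → index (walk k) ≡ k
  walk-index zero = refl
  walk-index (suc k) = trans (step-index (step-view (walk k))) (cong suc (walk-index k))
    where
    step-index : ∀ {s s′} → Step s s′ → index s′ ≡ suc (index s)
    step-index (advance-us {i} {j} _) = refl
    step-index (advance-vs {i} {j} _) = +-suc i j

  us-positive : All (0 <_) us
  us-positive = All.map proj₁ us-bounds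

  vs-positive : All (0 <_) vs
  vs-positive = All.map proj₁ vs-bounds

  advance-us-in-range : ∀ {i j} → i ≤ p → j ≤ q → i + j < N → P i ≤ Q j → i < p
  advance-us-in-range {i} {j} i≤p j≤q i+j<N P≤Q with m≤n⇒m<n∨m≡n i≤p
  ... | inj₁ i<p = i<p
  ... | inj₂ refl = ⊥-elim (<⇒≱ (sum-take-< j vs vs-positive (+-cancelˡ-< p j q i+j<N))
                                  (subst (_≤ Q j) (trans (sum-take-length us) sums) P≤Q))

  advance-vs-in-range : ∀ {i j} → i ≤ p → j ≤ q → i + j < N → Q j < P i → j < q
  advance-vs-in-range {i} {j} i≤p j≤q i+j<N Q<P with m≤n⇒m<n∨m≡n j≤q
  ... | inj₁ j<q = j<q
  ... | inj₂ refl = ⊥-elim (<⇒≯ (sum-take-< i us us-positive (+-cancelʳ-< q i p i+j<N))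
                                  (subst (_< P i) (trans (sum-take-length vs) (sym sums)) Q<P))

  record Invariant (s : ℕ × ℕ) : Set where
    constructor mkInvariant
    field
      i≤p : proj₁ s ≤ p
      j≤q : proj₂ s ≤ q
      Q<P+b : Q (proj₂ s) < P (proj₁ s) + b
      P≤Q+a : P (proj₁ s) ≤ Q (proj₂ s) + a

  invariant-step : ∀ {s s′} → Step s s′ → index s < N → Invariant s → Invariant s′
  invariant-step (advance-us {i} {j} P≤Q) i+j<N (mkInvariant i≤p j≤q Q<P+b P≤Q+a)
    with sum-take-suc i us us-bounds (advance-us-in-range i≤p j≤q i+j<N P≤Q)
  ... | x , (_ , x≤a) , P′≡ = mkInvariant
    (advance-us-in-range i≤p j≤q i+j<N P≤Q) j≤q
    (≤-trans Q<P+b (+-monoˡ-≤ b (≤-trans (m≤m+n (P i) x) (≤-reflexive (sym P′≡)))))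
    (≤-trans (≤-reflexive P′≡) (+-mono-≤ P≤Q x≤a))
  invariant-step (advance-vs {i} {j} Q<P) i+j<N (mkInvariant i≤p j≤q Q<P+b P≤Q+a)
    with sum-take-suc j vs vs-bounds (advance-vs-in-range i≤p j≤q i+j<N Q<P)
  ... | y , (_ , y≤b) , Q′≡ = mkInvariant
    i≤p (advance-vs-in-range i≤p j≤q i+j<N Q<P)
    (subst (_< P i + b) (sym Q′≡) (+-mono-<-≤ Q<P y≤b))
    (≤-trans P≤Q+a (+-monoˡ-≤ a (≤-trans (m≤m+n (Q j) y) (≤-reflexive (sym Q′≡)))))

  invariant : ∀ k → k ≤ N → Invariant (walk k)
  invariant zero _ = mkInvariant z≤n z≤n 0<b z≤n
  invariant (suc k) k<N = invariant-step (step-view (walk k)) (subst (_< N) (sym (walk-index k)) k<N)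
                                         (invariant k (<⇒≤ k<N))

  _≤²_ : ℕ × ℕ → ℕ × ℕ → Set
  (i , j) ≤² (i′ , j′) = i ≤ i′ × j ≤ j′

  walk-mono : ∀ {k l} → k ≤′ l → walk k ≤² walk l
  walk-mono ≤′-refl = ≤-refl , ≤-refl
  walk-mono (≤′-step {l} k≤l) = step-mono (step-view (walk l)) (walk-mono k≤l)
    where
    step-mono : ∀ {t s s′} → Step s s′ → t ≤² s → t ≤² s′
    step-mono (advance-us _) (i≤ , j≤) = m≤n⇒m≤1+n i≤ , j≤
    step-mono (advance-vs _) (i≤ , j≤) = i≤ , m≤n⇒m≤1+n j≤

  steps-unbalanced : ∀ {k l} → k < l → l < N →
                     P (proj₁ (walk k)) + Q (proj₂ (walk l)) ≢ P (proj₁ (walk l)) + Q (proj₂ (walk k))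
  steps-unbalanced {k} {l} k<l l<N cross = irreducible (window-split i m j n
    (subst (_≤ p) (sym i+m≡i′) (Invariant.i≤p (invariant l (<⇒≤ l<N))))
    (subst (_≤ q) (sym j+n≡j′) (Invariant.j≤q (invariant l (<⇒≤ l<N))))
    0<m+n m+n<N (cross-sums⇒windows us vs i≤i′ j≤j′ cross))
    where
    i j i′ j′ m n : ℕ
    i = proj₁ (walk k)
    j = proj₂ (walk k)
    i′ = proj₁ (walk l)
    j′ = proj₂ (walk l)
    m = i′ ∸ i
    n = j′ ∸ j
    i≤i′ : i ≤ i′
    i≤i′ = proj₁ (walk-mono (≤⇒≤′ (<⇒≤ k<l)))
    j≤j′ : j ≤ j′
    j≤j′ = proj₂ (walk-mono (≤⇒≤′ (<⇒≤ k<l)))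
    i+m≡i′ : i + m ≡ i′
    i+m≡i′ = m+[n∸m]≡n i≤i′
    j+n≡j′ : j + n ≡ j′
    j+n≡j′ = m+[n∸m]≡n j≤j′
    k+[m+n]≡l : k + (m + n) ≡ l
    k+[m+n]≡l = begin
      k + (m + n)        ≡⟨ cong (_+ (m + n)) (walk-index k) ⟨
      i + j + (m + n)    ≡⟨ interchange i j m n ⟩
      i + m + (j + n)    ≡⟨ cong₂ _+_ i+m≡i′ j+n≡j′ ⟩
      i′ + j′            ≡⟨ walk-index l ⟩
      l                  ∎
      where open ≡-Reasoning
    0<m+n : 0 < m + n
    0<m+n = +-cancelˡ-< k 0 (m + n) (subst₂ _<_ (sym (+-identityʳ k)) (sym k+[m+n]≡l) k<l)
    m+n<N : m + n < N
    m+n<N = ≤-<-trans (subst (m + n ≤_) k+[m+n]≡l (m≤n+m (m + n) k)) l<N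

  prefix-unbalanced : ∀ {i j} → i ≤ p → j ≤ q → 0 < i + j → i + j < N → P i ≢ Q j
  prefix-unbalanced {i} {j} i≤p j≤q 0<i+j i+j<N eq = irreducible (window-split 0 i 0 j i≤p j≤q 0<i+j i+j<N eq)

  -- An up-step starts from P < Q: P = Q would be a balanced pair of prefixes.
  step-below-max : ∀ {s s′} → Step s s′ → Invariant s → 0 < index s → index s < N →
                   P (proj₁ s′) < Q (proj₂ s′) + a
  step-below-max (advance-us {i} {j} P≤Q) (mkInvariant i≤p j≤q _ _) 0<i+j i+j<N
    with sum-take-suc i us us-bounds (advance-us-in-range i≤p j≤q i+j<N P≤Q)
  ... | x , (_ , x≤a) , P′≡ =
    subst (_< Q j + a) (sym P′≡) (+-mono-<-≤ (≤∧≢⇒< P≤Q (prefix-unbalanced i≤p j≤q 0<i+j i+j<N)) x≤a)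
  step-below-max (advance-vs {i} {j} Q<P) (mkInvariant i≤p j≤q _ P≤Q+a) _ i+j<N
    with sum-take-suc j vs vs-bounds (advance-vs-in-range i≤p j≤q i+j<N Q<P)
  ... | y , (0<y , _) , Q′≡ =
    subst (λ Q′ → P i < Q′ + a) (sym Q′≡) (≤-<-trans P≤Q+a (+-monoˡ-< a (m<m+n (Q j) 0<y)))

  below-max : P 1 < a → ∀ k → k < N → P (proj₁ (walk k)) < Q (proj₂ (walk k)) + a
  below-max P₁<a zero _ = ≤-trans (s≤s z≤n) P₁<a
  below-max P₁<a (suc zero) _ = P₁<a
  below-max P₁<a (suc (suc k)) k+2<N =
    step-below-max (step-view (walk (suc k))) (invariant (suc k) (<⇒≤ k+1<N))
      (subst (0 <_) (sym (walk-index (suc k))) z<s) (subst (_< N) (sym (walk-index (suc k))) k+1<N)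
    where
    k+1<N : suc k < N
    k+1<N = <-trans (n<1+n (suc k)) k+2<N

  -- P − Q + b − 1 at step k; by `Invariant` and `below-max` it lies in [0, a + b − 2].
  gap : ℕ → ℕ
  gap k = P (proj₁ (walk k)) + b ∸ suc (Q (proj₂ (walk k)))

  gap-< : P 1 < a → ∀ k → k < N → gap k < pred a + b
  gap-< P₁<a k k<N = m<n+o⇒m∸n<o (P i + b) (suc (Q j)) (begin-strict
    P i + b                   <⟨ +-monoˡ-< b (below-max P₁<a k k<N) ⟩
    Q j + a + b               ≡⟨ cong (λ c → Q j + c + b) (sym (suc-pred a)) ⟩
    Q j + suc (pred a) + b    ≡⟨ cong (_+ b) (+-suc (Q j) (pred a)) ⟩
    suc (Q j) + pred a + b    ≡⟨ +-assoc (suc (Q j)) (pred a) b ⟩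
    suc (Q j) + (pred a + b)  ∎)
    where
    i j : ℕ
    i = proj₁ (walk k)
    j = proj₂ (walk k)
    open ≤-Reasoning
    instance
      a≢0 : NonZero a
      a≢0 = >-nonZero (≤-trans (s≤s z≤n) P₁<a)
      a∸1+b≢0 : NonZero (pred a + b)
      a∸1+b≢0 = >-nonZero (≤-trans 0<b (m≤n+m b (pred a)))

  gap≡⇒cross-sums≡ : ∀ {k l} → k ≤ N → l ≤ N → gap k ≡ gap l →
              P (proj₁ (walk k)) + Q (proj₂ (walk l)) ≡ P (proj₁ (walk l)) + Q (proj₂ (walk k))
  gap≡⇒cross-sums≡ {k} {l} k≤N l≤N eq = +-cancelʳ-≡ (suc b) _ _ (begin
    P i + Q j′ + suc b     ≡⟨ swap-suc (P i) (Q j′) b ⟩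
    P i + b + suc (Q j′)   ≡⟨ ∸-cross (Invariant.Q<P+b (invariant k k≤N))
                                      (Invariant.Q<P+b (invariant l l≤N)) eq ⟩
    P i′ + b + suc (Q j)   ≡⟨ swap-suc (P i′) (Q j) b ⟨
    P i′ + Q j + suc b     ∎)
    where
    i j i′ j′ : ℕ
    i = proj₁ (walk k)
    j = proj₂ (walk k)
    i′ = proj₁ (walk l)
    j′ = proj₂ (walk l)
    open ≡-Reasoning
    swap-suc : ∀ x y c → x + y + suc c ≡ x + c + suc y
    swap-suc x y c = trans (+-suc (x + y) c) (trans (cong suc (xy∙z≈xz∙y x y c)) (sym (+-suc (x + c) y)))

  first<max⇒a+b≰N : P 1 < a → a + b ≤ N → ⊥
  first<max⇒a+b≰N P₁<a a+b≤N = repeated-gap (pigeonhole M<N f)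
    where
    f : Fin N → Fin (pred a + b)
    f k = fromℕ< (gap-< P₁<a (toℕ k) (toℕ<n k))
    M<N : pred a + b < N
    M<N = subst (λ c → c + b ≤ N) (sym (suc-pred a {{>-nonZero (≤-trans (s≤s z≤n) P₁<a)}})) a+b≤N
    repeated-gap : ∃₂ (λ k l → k Fin.< l × f k ≡ f l) → ⊥
    repeated-gap (k , l , k<l , fk≡fl) =
      steps-unbalanced k<l (toℕ<n l) (gap≡⇒cross-sums≡ (<⇒≤ (toℕ<n k)) (<⇒≤ (toℕ<n l))
        (trans (sym (toℕ-fromℕ< _)) (trans (cong toℕ fk≡fl) (toℕ-fromℕ< _))))

head≡max : ∀ {a b u us vs} → 0 < b →
           All (PositiveAtMost a) (u ∷ us) → All (PositiveAtMost b) vs → sum (u ∷ us) ≡ sum vs →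
           Irreducible (u ∷ us) vs → a + b ≤ length (u ∷ us) + length vs → u ≡ a
head≡max {a} {u = u} 0<b us-bounds vs-bounds sums irreducible a+b≤N with u <? a
... | yes u<a = ⊥-elim (Merge.first<max⇒a+b≰N 0<b us-bounds vs-bounds sums irreducible
                          (subst (_< a) (sym (+-identityʳ u)) u<a) a+b≤N)
... | no u≮a = ≤-antisym (proj₂ (All.head us-bounds)) (≮⇒≥ u≮a)

all≡max : ∀ {a b us vs} → 0 < b →
          All (PositiveAtMost a) us → All (PositiveAtMost b) vs → sum us ≡ sum vs →
          Irreducible us vs → a + b ≤ length us + length vs → All (_≡ a) us
all≡max {a} {b} {us} {vs} 0<b us-bounds vs-bounds sums irreducible a+b≤N = All.tabulate (at-front ∘ ∈-∃++)
  where
  at-front : ∀ {x} → ∃₂ (λ ys zs → us ≡ ys ++ x ∷ zs) → x ≡ a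
  at-front {x} (ys , zs , us≡) =
    head≡max 0<b (All-resp-↭ π us-bounds) vs-bounds (trans (sym (sum-↭ π)) sums)
      (irreducible ∘ BalancedSplit-↭ (↭-sym π)) (subst (λ n → a + b ≤ n + length vs) (↭-length π) a+b≤N)
    where
    π : us ↭ x ∷ ys ++ zs
    π = ↭-trans (↭-reflexive us≡) (shift x ys zs)

sum-const : ∀ {c xs} → All (_≡ c) xs → sum xs ≡ length xs * c
sum-const [] = refl
sum-const (refl ∷ eqs) = cong (_+_ _) (sum-const eqs)

sum-take-const : ∀ {c} k xs → All (_≡ c) xs → k ≤ length xs → sum (take k xs) ≡ k * c
sum-take-const {c} k xs eqs k≤ =
  trans (sum-const (take⁺ k eqs)) (cong (_* c) (length-take-drop 0 k xs k≤))

positive-factorˡ : ∀ {m n} → 0 < m * n → 0 < m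
positive-factorˡ {suc m} _ = z<s

positive-factorʳ : ∀ m {n} → 0 < m * n → 0 < n
positive-factorʳ m {n} = positive-factorˡ ∘ subst (0 <_) (*-comm m n)

constant-windows-split : ∀ {a b us vs α β} → All (_≡ a) us → All (_≡ b) vs →
                         0 < β → β < length us → α ≤ length vs → β * a ≡ α * b → BalancedSplit us vs
constant-windows-split {a} {b} {us} {vs} {α} {β} all-a all-b 0<β β<p α≤q βa≡αb =
  window-split 0 β 0 α (<⇒≤ β<p) α≤q (≤-trans 0<β (m≤m+n β α)) (+-mono-<-≤ β<p α≤q)
    (trans (sum-take-const β us all-a (<⇒≤ β<p)) (trans βa≡αb (sym (sum-take-const α vs all-b α≤q))))

equal-parts-coprime : ∀ {a b us vs} → 0 < a → 0 < b → All (_≡ a) us → All (_≡ b) vs →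
                      sum us ≡ sum vs → Irreducible us vs → a + b ≡ length us + length vs → Coprime a b
equal-parts-coprime {a} {b} {us} {vs} 0<a 0<b all-a all-b sums irreducible a+b≡N {d}
                    (divides α a≡αd , divides β b≡βd) = conclude (β <? length us)
  where
  open ≤-Reasoning
  instance
    b≢0 : NonZero b
    b≢0 = >-nonZero 0<b
  pa≡qb : length us * a ≡ length vs * b
  pa≡qb = trans (sym (sum-const all-a)) (trans sums (sum-const all-b))
  βa≡αb : β * a ≡ α * b
  βa≡αb = trans (cong (β *_) a≡αd) (trans (*-Properties.x∙yz≈y∙xz β α d) (cong (α *_) (sym b≡βd)))
  conclude : Dec (β < length us) → d ≡ 1
  conclude (yes β<p) = ⊥-elim (irreducible
    (constant-windows-split all-a all-b (positive-factorˡ (subst (0 <_) b≡βd 0<b)) β<p α≤q βa≡αb))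
    where
    α≤q : α ≤ length vs
    α≤q = *-cancelʳ-≤ α (length vs) b (begin
      α * b          ≡⟨ βa≡αb ⟨
      β * a          ≤⟨ *-monoˡ-≤ a (<⇒≤ β<p) ⟩
      length us * a  ≡⟨ pa≡qb ⟩
      length vs * b  ∎)
  conclude (no β≮p) = ≤-antisym d≤1 (positive-factorʳ α (subst (0 <_) a≡αd 0<a))
    where
    p≤β : length us ≤ β
    p≤β = ≮⇒≥ β≮p
    q≤α : length vs ≤ α
    q≤α = *-cancelʳ-≤ (length vs) α b (begin
      length vs * b  ≡⟨ pa≡qb ⟨
      length us * a  ≤⟨ *-monoˡ-≤ a p≤β ⟩
      β * a          ≡⟨ βa≡αb ⟩
      α * b          ∎)
    instance
      α+β≢0 : NonZero (α + β)
      α+β≢0 = >-nonZero (≤-trans (positive-factorˡ (subst (0 <_) a≡αd 0<a)) (m≤m+n α β))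
    d≤1 : d ≤ 1
    d≤1 = *-cancelˡ-≤ (α + β) (begin
      (α + β) * d              ≡⟨ *-distribʳ-+ d α β ⟩
      α * d + β * d            ≡⟨ cong₂ _+_ a≡αd b≡βd ⟨
      a + b                    ≡⟨ a+b≡N ⟩
      length us + length vs    ≤⟨ +-mono-≤ p≤β q≤α ⟩
      β + α                    ≡⟨ +-comm β α ⟩
      α + β                    ≡⟨ *-identityʳ (α + β) ⟨
      (α + β) * 1              ∎)

tight-irreducible⇒constant-coprime : ∀ {a b us vs} → 0 < a → 0 < b →
                    All (PositiveAtMost a) us → All (PositiveAtMost b) vs →
                    sum us ≡ sum vs → Irreducible us vs → a + b ≡ length us + length vs →
                    All (_≡ a) us × All (_≡ b) vs × Coprime a b
tight-irreducible⇒constant-coprime {a} {b} {us} {vs} 0<a 0<b us-bounds vs-bounds sums irreducible a+b≡N =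
  all-a , all-b , equal-parts-coprime 0<a 0<b all-a all-b sums irreducible a+b≡N
  where
  all-a : All (_≡ a) us
  all-a = all≡max 0<b us-bounds vs-bounds sums irreducible (≤-reflexive a+b≡N)
  all-b : All (_≡ b) vs
  all-b = all≡max 0<a vs-bounds us-bounds (sym sums) (irreducible ∘ BalancedSplit-swap)
            (≤-reflexive (trans (+-comm b a) (trans a+b≡N (+-comm (length us) (length vs)))))

-- Lists made of an up-run and a down-run

upDown : List ℕ → List ℕ → List ℤ
upDown us vs = map +_ us ++ map (-_ ∘ +_) vs

length-upDown : ∀ us vs → length (upDown us vs) ≡ length us + length vs
length-upDown us vs = trans (length-++ (map +_ us)) (cong₂ _+_ (length-map +_ us) (length-map (-_ ∘ +_) vs))

sumℤ-++ : ∀ xs ys → sumℤ (xs ++ ys) ≡ sumℤ xs ℤ.+ sumℤ ys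
sumℤ-++ [] ys = sym (ℤ.+-identityˡ (sumℤ ys))
sumℤ-++ (x ∷ xs) ys = trans (cong (ℤ._+_ x) (sumℤ-++ xs ys)) (sym (ℤ.+-assoc x _ _))

sumℤ-upDown : ∀ us vs → sumℤ (upDown us vs) ≡ + sum us ℤ.- + sum vs
sumℤ-upDown us vs = trans (sumℤ-++ (map +_ us) _) (cong₂ ℤ._+_ (sumℤ-ups us) (sumℤ-downs vs))
  where
  sumℤ-ups : ∀ us → sumℤ (map +_ us) ≡ + sum us
  sumℤ-ups [] = refl
  sumℤ-ups (u ∷ us) = trans (cong (ℤ._+_ (+ u)) (sumℤ-ups us)) (sym (ℤ.pos-+ u (sum us)))
  sumℤ-downs : ∀ vs → sumℤ (map (-_ ∘ +_) vs) ≡ - + sum vs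
  sumℤ-downs [] = refl
  sumℤ-downs (v ∷ vs) = trans (cong (ℤ._+_ (- + v)) (sumℤ-downs vs))
    (trans (sym (ℤ.neg-distrib-+ (+ v) (+ sum vs))) (cong -_ (sym (ℤ.pos-+ v (sum vs)))))

NonnegPrefixesFrom : ℤ → List ℤ → Set
NonnegPrefixesFrom c xs = All (λ ys → 0ℤ ℤ.≤ c ℤ.+ sumℤ ys) (inits xs)

nonnegPrefixes-∷ : ∀ {c x xs} → 0ℤ ℤ.≤ c → NonnegPrefixesFrom (c ℤ.+ x) xs → NonnegPrefixesFrom c (x ∷ xs)
nonnegPrefixes-∷ {c} {x} 0≤c prefixes =
  subst (0ℤ ℤ.≤_) (sym (ℤ.+-identityʳ c)) 0≤c ∷
  map⁺ (All.map (λ {ys} → subst (0ℤ ℤ.≤_) (ℤ.+-assoc c x (sumℤ ys))) prefixes)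

downs-nonnegPrefixes : ∀ c vs → sum vs ≤ c → NonnegPrefixesFrom (+ c) (map (-_ ∘ +_) vs)
downs-nonnegPrefixes c [] _ = subst (0ℤ ℤ.≤_) (sym (ℤ.+-identityʳ (+ c))) (+≤+ z≤n) ∷ []
downs-nonnegPrefixes c (v ∷ vs) v+s≤c = nonnegPrefixes-∷ (+≤+ z≤n)
  (subst (λ c′ → NonnegPrefixesFrom c′ (map (-_ ∘ +_) vs)) c∸v≡c-v
    (downs-nonnegPrefixes (c ∸ v) vs (subst (_≤ c ∸ v) (m+n∸m≡n v (sum vs)) (∸-monoˡ-≤ v v+s≤c))))
  where
  c∸v≡c-v : + (c ∸ v) ≡ + c ℤ.- + v
  c∸v≡c-v = trans (sym (ℤ.⊖-≥ (m+n≤o⇒m≤o v v+s≤c))) (sym (ℤ.m-n≡m⊖n c v))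

upDown-nonnegPrefixes : ∀ c us vs → sum vs ≤ c + sum us → NonnegPrefixesFrom (+ c) (upDown us vs)
upDown-nonnegPrefixes c [] vs s≤c = downs-nonnegPrefixes c vs (subst (sum vs ≤_) (+-identityʳ c) s≤c)
upDown-nonnegPrefixes c (u ∷ us) vs s≤c = nonnegPrefixes-∷ (+≤+ z≤n)
  (subst (λ c′ → NonnegPrefixesFrom c′ (upDown us vs)) (ℤ.pos-+ c u)
    (upDown-nonnegPrefixes (c + u) us vs (subst (sum vs ≤_) (sym (+-assoc c u (sum us))) s≤c)))

GenCatalan-upDown⁺ : ∀ us vs → sum us ≡ sum vs → GenCatalan (upDown us vs)
GenCatalan-upDown⁺ us vs sums =
  trans (sumℤ-upDown us vs) (ℤ.i≡j⇒i-j≡0 (cong +_ sums)) ,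
  All.map (λ {ys} → subst (0ℤ ℤ.≤_) (ℤ.+-identityˡ (sumℤ ys)))
    (upDown-nonnegPrefixes 0 us vs (≤-reflexive (sym sums)))

GenCatalan-upDown⁻ : ∀ us vs → GenCatalan (upDown us vs) → sum us ≡ sum vs
GenCatalan-upDown⁻ us vs (sum≡0 , _) =
  ℤ.+-injective (ℤ.i-j≡0⇒i≡j (+ sum us) (+ sum vs) (trans (sym (sumℤ-upDown us vs)) sum≡0))

select≡sel : ∀ m xs → select m xs ≡ sel m xs
select≡sel [] xs = refl
select≡sel (_ ∷ _) [] = refl
select≡sel (true ∷ m) (x ∷ xs) = cong (x ∷_) (select≡sel m xs)
select≡sel (false ∷ m) (x ∷ xs) = select≡sel m xs

select-upDown : ∀ mu mv us vs → length mu ≡ length us →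
                select (mu ++ mv) (upDown us vs) ≡ upDown (sel mu us) (sel mv vs)
select-upDown mu mv us vs eq = begin
  select (mu ++ mv) (upDown us vs)                      ≡⟨ select≡sel (mu ++ mv) (upDown us vs) ⟩
  sel (mu ++ mv) (map +_ us ++ map (-_ ∘ +_) vs)        ≡⟨ sel-++ mu mv _ _ (trans eq (sym (length-map +_ us))) ⟩
  sel mu (map +_ us) ++ sel mv (map (-_ ∘ +_) vs)       ≡⟨ cong₂ _++_ (sel-map +_ mu us) (sel-map (-_ ∘ +_) mv vs) ⟩
  upDown (sel mu us) (sel mv vs)                        ∎
  where open ≡-Reasoning

upDown-nonempty : ∀ us vs → 0 < length us + length vs → NonEmpty (upDown us vs)
upDown-nonempty (u ∷ us) vs _ = + u , _ , refl
upDown-nonempty [] (v ∷ vs) _ = - + v , _ , refl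

BalancedSplit⇒Reducible : ∀ {us vs} → sum us ≡ sum vs → BalancedSplit us vs → Reducible (upDown us vs)
BalancedSplit⇒Reducible {us} {vs} sums s =
  mu ++ mv , length-mask ,
  subst NonEmpty (sym chosen) (upDown-nonempty (sel mu us) (sel mv vs) nonempty) ,
  subst NonEmpty (sym rest) (upDown-nonempty (sel (map not mu) us) (sel (map not mv) vs) co-nonempty) ,
  subst GenCatalan (sym chosen) (GenCatalan-upDown⁺ (sel mu us) (sel mv vs) balanced) ,
  subst GenCatalan (sym rest) (GenCatalan-upDown⁺ (sel (map not mu) us) (sel (map not mv) vs) co-balanced)
  where
  open BalancedSplit s
  open ≡-Reasoning
  length-mask : length (mu ++ mv) ≡ length (upDown us vs)
  length-mask = trans (length-++ mu) (trans (cong₂ _+_ length-mu length-mv) (sym (length-upDown us vs)))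
  chosen : select (mu ++ mv) (upDown us vs) ≡ upDown (sel mu us) (sel mv vs)
  chosen = select-upDown mu mv us vs length-mu
  rest : select (map not (mu ++ mv)) (upDown us vs) ≡ upDown (sel (map not mu) us) (sel (map not mv) vs)
  rest = trans (cong (λ m → select m (upDown us vs)) (map-++ not mu mv))
               (select-upDown (map not mu) (map not mv) us vs (trans (length-map not mu) length-mu))
  co-balanced : sum (sel (map not mu) us) ≡ sum (sel (map not mv) vs)
  co-balanced = +-cancelˡ-≡ (sum (sel mu us)) _ _ (begin
    sum (sel mu us) + sum (sel (map not mu) us)   ≡⟨ sum-sel-complement mu us length-mu ⟩
    sum us                                        ≡⟨ sums ⟩
    sum vs                                        ≡⟨ sum-sel-complement mv vs length-mv ⟨
    sum (sel mv vs) + sum (sel (map not mv) vs)   ≡⟨ cong (_+ _) balanced ⟨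
    sum (sel mu us) + sum (sel (map not mv) vs)   ∎)

SignBreak : ℤ → List (List ℤ) → Set
SignBreak x [] = ⊤
SignBreak x ([] ∷ _) = ⊥
SignBreak x ((y ∷ _) ∷ _) = isPos x ≢ isPos y

data Alternating : List (List ℤ) → Set where
  [] : Alternating []
  run : ∀ {x r rs} → All (λ e → isPos e ≡ isPos x) r → SignBreak x rs → Alternating rs →
        Alternating ((x ∷ r) ∷ rs)

SignBreak-resp : ∀ {x y} rs → isPos x ≡ isPos y → SignBreak y rs → SignBreak x rs
SignBreak-resp [] _ _ = tt
SignBreak-resp ((_ ∷ _) ∷ _) x~y break = break ∘ trans (sym x~y)

runs-alternating : ∀ xs → Alternating (runs xs)
runs-alternating [] = []
runs-alternating (x ∷ xs) = insert (runs-alternating xs)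
  where
  -- The sign b is a parameter because `with` turns `isPos y` into a literal in the type of `same`.
  extend : ∀ {b y r rs} → isPos x ≡ b → isPos y ≡ b → All (λ e → isPos e ≡ b) r → SignBreak y rs →
           Alternating rs → Alternating ((x ∷ y ∷ r) ∷ rs)
  extend {rs = rs} x± y± same break rest =
    run (trans y± (sym x±) ∷ All.map (λ e± → trans e± (sym x±)) same)
        (SignBreak-resp rs (trans x± (sym y±)) break) rest
  new-run : ∀ {b c y r rs} → isPos x ≡ b → isPos y ≡ c → b ≢ c → All (λ e → isPos e ≡ c) r →
            SignBreak y rs → Alternating rs → Alternating ((x ∷ []) ∷ (y ∷ r) ∷ rs)
  new-run x± y± b≢c same break rest =
    run [] (subst₂ _≢_ (sym x±) (sym y±) b≢c) (run (All.map (λ e± → trans e± (sym y±)) same) break rest)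
  insert : ∀ {rs} → Alternating rs → Alternating (insertRun x rs)
  insert [] = run [] tt []
  insert (run {y} same break rest) with isPos x in x± | isPos y in y±
  ... | true  | true  = extend x± y± same break rest
  ... | false | false = extend x± y± same break rest
  ... | true  | false = new-run x± y± (λ ()) same break rest
  ... | false | true  = new-run x± y± (λ ()) same break rest

concat-runs : ∀ xs → concat (runs xs) ≡ xs
concat-runs [] = refl
concat-runs (x ∷ xs) = trans (concat-insertRun (runs xs)) (cong (x ∷_) (concat-runs xs))
  where
  concat-insertRun : ∀ rs → concat (insertRun x rs) ≡ x ∷ concat rs
  concat-insertRun [] = refl
  concat-insertRun ([] ∷ rs) = refl
  concat-insertRun ((y ∷ r) ∷ rs) with isPos x | isPos y
  ... | true  | true  = refl
  ... | false | false = refl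
  ... | true  | false = refl
  ... | false | true  = refl

isPos-true : ∀ {e} → isPos e ≡ true → 0ℤ ℤ.< e
isPos-true {e} e± with 0ℤ ℤ.<? e
... | yes 0<e = 0<e

isPos-false : ∀ {e} → isPos e ≡ false → e ≢ 0ℤ → e ℤ.< 0ℤ
isPos-false {e} e± e≢0 with 0ℤ ℤ.<? e
... | no 0≮e = ℤ.≤∧≢⇒< (ℤ.≮⇒≥ 0≮e) e≢0

record TwoRuns (xs up down : List ℤ) : Set where
  field
    split : xs ≡ up ++ down
    up-nonempty : NonEmpty up
    down-nonempty : NonEmpty down
    up-positive : All (0ℤ ℤ.<_) up
    down-negative : All (ℤ._< 0ℤ) down

alternating-two-runs : ∀ {xs up down} → Alternating (up ∷ down ∷ []) → xs ≡ up ++ down →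
                       NonzeroList xs → GenCatalan xs → TwoRuns xs up down
alternating-two-runs (run {x} {r} same-up break (run {y} {r′} same-down _ [])) refl
                     (x≢0 ∷ nonzero) (_ , _ ∷ x≥0 ∷ _) =
  record
  { split = refl
  ; up-nonempty = x , r , refl
  ; down-nonempty = y , r′ , refl
  ; up-positive = 0<x ∷ All.map (λ e~x → isPos-true (trans e~x x±)) same-up
  ; down-negative = All.zipWith (λ (e± , e≢0) → isPos-false e± e≢0)
                      (y± ∷ All.map (λ e~y → trans e~y y±) same-down , ++⁻ʳ r nonzero)
  }
  where
  0<x : 0ℤ ℤ.< x
  0<x = ℤ.≤∧≢⇒< (subst (0ℤ ℤ.≤_) (ℤ.+-identityʳ x) x≥0) (x≢0 ∘ sym)
  x± : isPos x ≡ true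
  x± = dec-true (0ℤ ℤ.<? x) 0<x
  y± : isPos y ≡ false
  y± = trans (¬-not (break ∘ sym)) (cong not x±)

two-runs : ∀ {xs up down} → NonzeroList xs → GenCatalan xs → runs xs ≡ up ∷ down ∷ [] → TwoRuns xs up down
two-runs {xs} {up} {down} nonzero catalan runs≡ =
  alternating-two-runs (subst Alternating runs≡ (runs-alternating xs)) split nonzero catalan
  where
  split : xs ≡ up ++ down
  split = trans (sym (concat-runs xs)) (trans (cong concat runs≡) (cong (up ++_) (++-identityʳ down)))

upDown-abs : ∀ {up down} → All (0ℤ ℤ.<_) up → All (ℤ._< 0ℤ) down →
             up ++ down ≡ upDown (map ∣_∣ up) (map ∣_∣ down)
upDown-abs {up} {down} positive negative = cong₂ _++_
  (sym (trans (sym (map-∘ up)) (map-id-local (All.map (ℤ.0≤i⇒+∣i∣≡i ∘ ℤ.<⇒≤) positive))))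
  (sym (trans (sym (map-∘ down)) (map-id-local (All.map -∣i∣≡i negative))))
  where
  -∣i∣≡i : ∀ {i} → i ℤ.< 0ℤ → - + ∣ i ∣ ≡ i
  -∣i∣≡i { -[1+ n ]} _ = refl
  -∣i∣≡i {+ n} (+<+ ())

upDown-entries : ∀ {a b us vs} → All (_≡ a) us → All (_≡ b) vs →
                 All (λ e → e ≡ + a ⊎ e ≡ - (+ b)) (upDown us vs)
upDown-entries all-a all-b =
  ++⁺ (map⁺ (All.map (inj₁ ∘ cong (+_)) all-a)) (map⁺ (All.map (inj₂ ∘ cong (-_ ∘ +_)) all-b))

abs-bounds : ∀ l → NonzeroList l → All (PositiveAtMost (maxAbs l)) (map ∣_∣ l)
abs-bounds [] [] = []
abs-bounds (e ∷ l) (e≢0 ∷ nonzero) =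
  (n≢0⇒n>0 (e≢0 ∘ ℤ.∣i∣≡0⇒i≡0) , m≤m⊔n ∣ e ∣ (maxAbs l)) ∷
  All.map (λ (0<x , x≤max) → 0<x , ≤-trans x≤max (m≤n⊔m ∣ e ∣ (maxAbs l))) (abs-bounds l nonzero)

bound-positive : ∀ {c xs} → NonEmpty xs → All (PositiveAtMost c) (map ∣_∣ xs) → 0 < c
bound-positive (_ , _ , refl) ((0<x , x≤c) ∷ _) = ≤-trans 0<x x≤c

theorem3p2 : (xs : List ℤ) (up down : List ℤ) → NonzeroList xs → GenCatalan xs
    → runs xs ≡ up ∷ down ∷ [] → cost xs ≡ width xs → ¬ Reducible xs
    → All (λ e → e ≡ + maxAbs up ⊎ e ≡ - (+ maxAbs down)) xs
      × Coprime (maxAbs up) (maxAbs down)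
theorem3p2 xs up down nonzero catalan runs≡ cost≡width irreducible =
  let up-constant , down-constant , coprime =
        tight-irreducible⇒constant-coprime (bound-positive up-nonempty up-bounds) (bound-positive down-nonempty down-bounds)
          up-bounds down-bounds sums (irreducible ∘ subst Reducible (sym shape) ∘ BalancedSplit⇒Reducible sums) tight
  in subst (All _) (sym shape) (upDown-entries up-constant down-constant) , coprime
  where
  open TwoRuns (two-runs nonzero catalan runs≡)
  ∣up∣ ∣down∣ : List ℕ
  ∣up∣ = map ∣_∣ up
  ∣down∣ = map ∣_∣ down
  shape : xs ≡ upDown ∣up∣ ∣down∣
  shape = trans split (upDown-abs up-positive down-negative)
  up-bounds : All (PositiveAtMost (maxAbs up)) ∣up∣
  up-bounds = abs-bounds up (++⁻ˡ up (subst NonzeroList split nonzero))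
  down-bounds : All (PositiveAtMost (maxAbs down)) ∣down∣
  down-bounds = abs-bounds down (++⁻ʳ up (subst NonzeroList split nonzero))
  sums : sum ∣up∣ ≡ sum ∣down∣
  sums = GenCatalan-upDown⁻ ∣up∣ ∣down∣ (subst GenCatalan shape catalan)
  tight : maxAbs up + maxAbs down ≡ length ∣up∣ + length ∣down∣
  tight = begin
    maxAbs up + maxAbs down          ≡⟨ cong (_+_ (maxAbs up)) (+-identityʳ (maxAbs down)) ⟨
    maxAbs up + (maxAbs down + 0)    ≡⟨ cong (foldr _+_ 0 ∘ map maxAbs) runs≡ ⟨
    cost xs                          ≡⟨ cost≡width ⟩
    length xs                        ≡⟨ trans (cong length shape) (length-upDown ∣up∣ ∣down∣) ⟩
    length ∣up∣ + length ∣down∣      ∎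
    where open ≡-Reasoning
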